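{- Let $\pi=a_1a_2\cdots a_n\in\mathfrak{S}_n$ be a separable permutation with $a_1<a_n$, and let $(i_1,\dots,i_\ell)$ be a reduced decomposition of $\pi$. Then there exists an integer $m$ with $1\le m<n$ such that none of the simple transpositions $s_{i_j}$ transposes an element of $\{1,2,\dots,m\}$ with an element of $\{m+1,\dots,n\}$; that is, for the saturated chain $\mathrm{id}=\pi_0\lessdot\pi_1\lessdot\cdots\lessdot\pi_\ell=\pi$ with $\pi_j=\pi_{j-1}s_{i_j}$, no step swaps (the adjacent entries in positions $i_j,i_j+1$ of $\pi_{j-1}$ being) a letter in $\{1,\dots,m\}$ and a letter in $\{m+1,\dots,n\}$.
   Context: $\mathfrak{S}_n$ is the symmetric group on $\{1,\dots,n\}$, permutations in one-line notation, products composed right-to-left, so $\pi s_i$ is obtained from $\pi$ by swapping the entries in positions $i$ and $i+1$, where $s_i=(i,i+1)$. Length $\ell(\pi)=\#\{i<j:a_i>a_j\}$. A reduced decomposition of $\pi$ is a sequence $(i_1,\dots,i_\ell)$ with $\pi=s_{i_1}s_{i_2}\cdots s_{i_\ell}$ and $\ell=\ell(\pi)$. The weak order is generated by covers $\pi\lessdot\sigma$ when $\sigma=\pi s_i$ and $\ell(\sigma)>\ell(\pi)$. A permutation is separable if it is 3142-avoiding and 2413-avoiding, i.e. there are no $i<j<k<h$ with $a_j<a_h<a_i<a_k$ or $a_k<a_i<a_h<a_j$. -}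

module Defs where

open import Data.Nat as ℕ using (ℕ; zero; suc; _+_)
open import Data.Fin using (Fin; toℕ; _<_; _≟_; inject₁)
open import Data.List using (_++_; List; []; _∷_; length; filter; allFin; concatMap; map)
open import Data.Product using (_×_; Σ; _,_)
open import Data.Sum using (_⊎_)
open import Relation.Nullary using (yes; no; ¬_)
open import Relation.Nullary.Decidable using (_×-dec_)
open import Relation.Binary.PropositionalEquality using (_≡_)
open import Function.Definitions using (Injective)
import Data.Fin as F

-- Conventions: a permutation of {1,…,n} in one-line notation is an injective
-- (hence bijective) map  Fin n → Fin n  (position ↦ letter); Fin value k
-- stands for the number k+1, both for positions and for letters.
record Perm (n : ℕ) : Set where
  constructor perm
  field
    word : Fin n → Fin n
    inj  : Injective _≡_ _≡_ word
open Perm public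

-- The index i : Fin n
-- with toℕ i = k encodes s_{k+1}, which exchanges positions k+1 and k+2
-- (1-based), i.e. the Fin elements  inject₁ i  and  suc i.
s : {n : ℕ} → Fin n → Fin (suc n) → Fin (suc n)
s i p with p ≟ inject₁ i
... | yes _ = F.suc i
... | no _ with p ≟ F.suc i
...   | yes _ = inject₁ i
...   | no _ = p

-- Word of π s_i: entries in positions i, i+1 swapped (composition right-to-left).
_·s_ : {n : ℕ} → (Fin (suc n) → Fin (suc n)) → Fin n → (Fin (suc n) → Fin (suc n))
(w ·s i) p = w (s i p)

-- Product s_{i_1} s_{i_2} ⋯ s_{i_ℓ} as a word, computed along the chain
-- π_0 = id, π_j = π_{j-1} s_{i_j}.
prodFrom : {n : ℕ} → (Fin (suc n) → Fin (suc n)) → List (Fin n) → (Fin (suc n) → Fin (suc n))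
prodFrom w [] = w
prodFrom w (i ∷ is) = prodFrom (w ·s i) is

prod : {n : ℕ} → List (Fin n) → (Fin (suc n) → Fin (suc n))
prod is = prodFrom (λ p → p) is

inversions : {n : ℕ} → (Fin n → Fin n) → List (Fin n × Fin n)
inversions {n} w =
  filter (λ { (i , j) → (i F.<? j) ×-dec (w j F.<? w i) })
    (concatMap (λ i → map (λ j → (i , j)) (allFin n)) (allFin n))

len : {n : ℕ} → (Fin n → Fin n) → ℕ
len w = length (inversions w)

ReducedDecomposition : {n : ℕ} → Perm (suc n) → List (Fin n) → Set
ReducedDecomposition π is =
  ((p : Fin _) → prod is p ≡ word π p) × (length is ≡ len (word π))

-- Separable: no i<j<k<h with a_j<a_h<a_i<a_k (3142) or a_k<a_i<a_h<a_j (2413).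
Separable : {n : ℕ} → Perm n → Set
Separable {n} π = (i j k h : Fin n) → i < j → j < k → k < h →
  ¬ ((word π j < word π h) × (word π h < word π i) × (word π i < word π k))
  × ¬ ((word π k < word π i) × (word π i < word π h) × (word π h < word π j))

-- Letter x lies in {1,…,m}  (x : Fin N encodes the letter toℕ x + 1).
InLow : {N : ℕ} → ℕ → Fin N → Set
InLow m x = toℕ x ℕ.< m

Separated : {N : ℕ} → ℕ → Fin N → Fin N → Set
Separated m x y = (InLow m x × ¬ InLow m y) ⊎ (¬ InLow m x × InLow m y)

-- The j-th step π_{j-1} ⋖ π_{j-1} s_{i_j} of the chain swaps the letters in
-- positions i_j, i_j+1 of π_{j-1} = prod (i_1 … i_{j-1}).
NoStepCrosses : {n : ℕ} → ℕ → List (Fin n) → Set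
NoStepCrosses {n} m is = (pre post : List (Fin n)) (i : Fin n) → is ≡ pre ++ i ∷ post →
  ¬ Separated m (prod pre (inject₁ i)) (prod pre (F.suc i))

module Submission where

open import Defs
open import Data.Nat using (ℕ; suc; _≤_; _<_)
open import Data.Fin using (Fin; zero; fromℕ)
open import Data.List using (List)
open import Data.Product using (Σ; _×_)

open import Data.Nat as ℕ using (zero; _+_; z≤n; s≤s)
open import Data.Nat.Properties as ℕP using (≤-refl; ≤-trans; +-mono-≤)
open import Data.Fin as F using (toℕ; inject₁; _≟_)
open import Data.Fin.Properties as FP
  using ( toℕ-injective; toℕ-inject₁; suc-injective; toℕ<n; toℕ-fromℕ; toℕ-fromℕ<; toℕ-inject≤
        ; inject≤-injective; punchOut-injective; injective⇒≤; any?; all?; ¬∀⟶∃¬)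
open import Data.Fin.Permutation using (permutation)
open import Data.List using (allFin; []; _∷_; _++_; length; filter; map; concat; tabulate)
open import Data.List.Properties using (length-++; filter-++; map-tabulate)
open import Data.Product using (_,_; proj₁; proj₂; ∃; ∃₂)
open import Data.Sum using (_⊎_; inj₁; inj₂)
open import Data.Unit using (⊤; tt)
open import Data.Empty using (⊥; ⊥-elim)
open import Data.Bool using (if_then_else_)
open import Relation.Nullary using (Dec; yes; no; ¬_; does)
open import Relation.Nullary.Decidable using (_×-dec_; _→-dec_; decidable-stable)
open import Relation.Unary using (Pred; Decidable)
open import Relation.Binary.PropositionalEquality
  using (_≡_; _≢_; refl; sym; trans; cong; cong-app; subst; subst₂; _≗_; module ≡-Reasoning)
open import Function using (_∘_; id)
open import Function.Definitions using (Injective)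
open import Level using (0ℓ)
open import Algebra.Properties.CommutativeMonoid.Sum ℕP.+-0-commutativeMonoid
  using (sum; sum-cong-≗; sum-replicate-zero; ∑-permute)
open import Algebra.Properties.CommutativeSemigroup ℕP.+-commutativeSemigroup using (x∙yz≈y∙xz)

-- Write ℓ for the number of inversions.  Swapping the entries in
-- positions i, i+1 of a word w changes its inversions only at that pair, so
-- ℓ(w s_i) ≤ [w(i) < w(i+1)] + ℓ(w).  Along a chain id = π₀ ⋖ ⋯ ⋖ π_ℓ = π of a
-- reduced decomposition the length rises by one at every step, so every step
-- is an ascent: it swaps letters u < v, creating the inversion "v before u",
-- and later ascent steps never undo an inversion.  Hence every swapped pair
-- u < v appears inverted in π itself.
--   On the other hand a separable π with a₁ < aₙ is a direct sum: with k the
-- last position holding a letter smaller than a₁, every letter ≤ k+1 occurs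
-- before every letter > k+1, for otherwise a counting (pigeonhole) argument
-- produces positions 1 < p < k < q carrying the pattern 2413.  Taking m = k+1
-- (or m = 1 if a₁ = 1), a swap of a letter ≤ m with one > m would be an
-- inversion of π across the direct sum, which is impossible.

module _ {n : ℕ} (i : Fin n) where

  inject₁<suc : inject₁ i F.< F.suc i
  inject₁<suc = s≤s (ℕP.≤-reflexive (toℕ-inject₁ i))

  suc≢inject₁ : F.suc i ≢ inject₁ i
  suc≢inject₁ e = ℕP.1+n≢n (trans (cong toℕ e) (toℕ-inject₁ i))

  data Place (p : Fin (suc n)) : Set where
    left  : p ≡ inject₁ i → Place p
    right : p ≡ F.suc i → Place p
    other : p ≢ inject₁ i → p ≢ F.suc i → Place p

  place : (p : Fin (suc n)) → Place p
  place p with p ≟ inject₁ i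
  ... | yes e = left e
  ... | no ¬l with p ≟ F.suc i
  ...   | yes e = right e
  ...   | no ¬r = other ¬l ¬r

  s-left : s i (inject₁ i) ≡ F.suc i
  s-left with inject₁ i ≟ inject₁ i
  ... | yes _ = refl
  ... | no ne = ⊥-elim (ne refl)

  s-right : s i (F.suc i) ≡ inject₁ i
  s-right with F.suc i ≟ inject₁ i
  ... | yes e = ⊥-elim (suc≢inject₁ e)
  ... | no _ with F.suc i ≟ F.suc i
  ...   | yes _ = refl
  ...   | no ne = ⊥-elim (ne refl)

  s-other : {p : Fin (suc n)} → p ≢ inject₁ i → p ≢ F.suc i → s i p ≡ p
  s-other {p} ¬l ¬r with p ≟ inject₁ i
  ... | yes e = ⊥-elim (¬l e)
  ... | no _ with p ≟ F.suc i
  ...   | yes e = ⊥-elim (¬r e)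
  ...   | no _ = refl

  s-involutive : (p : Fin (suc n)) → s i (s i p) ≡ p
  s-involutive p with place p
  ... | left refl = trans (cong (s i) s-left) s-right
  ... | right refl = trans (cong (s i) s-right) s-left
  ... | other ¬l ¬r = trans (cong (s i) (s-other ¬l ¬r)) (s-other ¬l ¬r)

  s-preserves-< : {p q : Fin (suc n)} → ¬ (p ≡ inject₁ i × q ≡ F.suc i) →
    p F.< q → s i p F.< s i q
  s-preserves-< {p} {q} notPair p<q with place p | place q
  ... | left refl | left refl = ⊥-elim (ℕP.<-irrefl refl p<q)
  ... | left refl | right refl = ⊥-elim (notPair (refl , refl))
  ... | right refl | left refl = ⊥-elim (ℕP.<-asym p<q inject₁<suc)
  ... | right refl | right refl = ⊥-elim (ℕP.<-irrefl refl p<q)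
  ... | left refl | other ¬l ¬r rewrite s-left | s-other ¬l ¬r =
    ℕP.≤∧≢⇒< (subst (λ k → suc k ≤ toℕ q) (toℕ-inject₁ i) p<q) (λ e → ¬r (sym (toℕ-injective e)))
  ... | right refl | other ¬l ¬r rewrite s-right | s-other ¬l ¬r =
    ℕP.<-trans inject₁<suc p<q
  ... | other ¬l ¬r | left refl rewrite s-left | s-other ¬l ¬r =
    ℕP.<-trans p<q inject₁<suc
  ... | other ¬l ¬r | right refl rewrite s-right | s-other ¬l ¬r =
    ℕP.≤∧≢⇒< (subst (toℕ p ℕ.≤_) (sym (toℕ-inject₁ i)) (ℕP.≤-pred p<q))
      (λ e → ¬l (toℕ-injective e))
  ... | other ¬l ¬r | other ¬l′ ¬r′ rewrite s-other ¬l ¬r | s-other ¬l′ ¬r′ = p<q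

  s-reflects-< : {p q : Fin (suc n)} → ¬ (p ≡ F.suc i × q ≡ inject₁ i) →
    s i p F.< s i q → p F.< q
  s-reflects-< {p} {q} notPair sp<sq =
    subst₂ F._<_ (s-involutive p) (s-involutive q) (s-preserves-< notPair′ sp<sq)
    where
    notPair′ : ¬ (s i p ≡ inject₁ i × s i q ≡ F.suc i)
    notPair′ (ep , eq) = notPair
      ( trans (sym (s-involutive p)) (trans (cong (s i) ep) s-left)
      , trans (sym (s-involutive q)) (trans (cong (s i) eq) s-right))

-- Counting inversions: ℓ(w) is a double sum of 0/1 indicators over pairs of
-- positions, which can then be reindexed and compared termwise.

⟦_⟧ : {A : Set} → Dec A → ℕ
⟦ d ⟧ = if does d then 1 else 0

⟦⟧-mono : {A B : Set} (a? : Dec A) (b? : Dec B) → (A → B) → ⟦ a? ⟧ ≤ ⟦ b? ⟧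
⟦⟧-mono (yes a) (yes _) A→B = ≤-refl
⟦⟧-mono (yes a) (no ¬b) A→B = ⊥-elim (¬b (A→B a))
⟦⟧-mono (no _)  _       A→B = z≤n

⟦⟧-refuted : {A : Set} (a? : Dec A) → ¬ A → ⟦ a? ⟧ ≡ 0
⟦⟧-refuted (yes a) ¬a = ⊥-elim (¬a a)
⟦⟧-refuted (no _)  ¬a = refl

⟦⟧≤1 : {A : Set} (a? : Dec A) → ⟦ a? ⟧ ≤ 1
⟦⟧≤1 (yes _) = ≤-refl
⟦⟧≤1 (no _)  = z≤n

sum-mono : {N : ℕ} {f g : Fin N → ℕ} → (∀ a → f a ≤ g a) → sum f ≤ sum g
sum-mono {zero}  f≤g = z≤n
sum-mono {suc N} f≤g = +-mono-≤ (f≤g zero) (sum-mono (f≤g ∘ F.suc))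

sum-≤-except : {N : ℕ} {f g : Fin N → ℕ} (x : Fin N) (c : ℕ) →
  (∀ a → a ≢ x → f a ≤ g a) → f x ≤ c + g x → sum f ≤ c + sum g
sum-≤-except {suc N} {f} {g} zero c f≤g fx≤ =
  subst (sum f ≤_) (ℕP.+-assoc c (g zero) _)
    (+-mono-≤ fx≤ (sum-mono (λ a → f≤g (F.suc a) λ ())))
sum-≤-except {suc N} {f} {g} (F.suc x) c f≤g fx≤ =
  subst (sum f ≤_) (x∙yz≈y∙xz (g zero) c _)
    (+-mono-≤ (f≤g zero λ ())
      (sum-≤-except x c (λ a a≢x → f≤g (F.suc a) (a≢x ∘ suc-injective)) fx≤))

module _ {A : Set} {P : Pred A 0ℓ} (P? : Decidable P) where

  count-tabulate : {N : ℕ} (g : Fin N → A) →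
    length (filter P? (tabulate g)) ≡ sum (λ a → ⟦ P? (g a) ⟧)
  count-tabulate {zero}  g = refl
  count-tabulate {suc N} g with P? (g zero)
  ... | yes _ = cong suc (count-tabulate (g ∘ F.suc))
  ... | no _  = count-tabulate (g ∘ F.suc)

  count-concat : {N : ℕ} (G : Fin N → List A) →
    length (filter P? (concat (tabulate G))) ≡ sum (λ a → length (filter P? (G a)))
  count-concat {zero}  G = refl
  count-concat {suc N} G = begin
    length (filter P? (G zero ++ concat (tabulate (G ∘ F.suc))))
      ≡⟨ cong length (filter-++ P? (G zero) _) ⟩
    length (filter P? (G zero) ++ filter P? (concat (tabulate (G ∘ F.suc))))
      ≡⟨ length-++ (filter P? (G zero)) ⟩
    length (filter P? (G zero)) + length (filter P? (concat (tabulate (G ∘ F.suc))))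
      ≡⟨ cong (length (filter P? (G zero)) +_) (count-concat (G ∘ F.suc)) ⟩
    sum (λ a → length (filter P? (G a))) ∎
    where open ≡-Reasoning

inversion? : {N : ℕ} (w : Fin N → Fin N) (a b : Fin N) → Dec (a F.< b × w b F.< w a)
inversion? w a b = (a F.<? b) ×-dec (w b F.<? w a)

len-as-sum : {N : ℕ} (w : Fin N → Fin N) →
  len w ≡ sum (λ a → sum (λ b → ⟦ inversion? w a b ⟧))
len-as-sum {N} w = begin
  length (filter P? (concat (map row (tabulate id))))
    ≡⟨ cong (length ∘ filter P? ∘ concat) (map-tabulate id row) ⟩
  length (filter P? (concat (tabulate row)))
    ≡⟨ count-concat P? row ⟩
  sum (λ a → length (filter P? (row a)))
    ≡⟨ sum-cong-≗ (λ a → trans (cong (length ∘ filter P?) (map-tabulate id (a ,_)))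
                               (count-tabulate P? (a ,_))) ⟩
  sum (λ a → sum (λ b → ⟦ inversion? w a b ⟧)) ∎
  where
  open ≡-Reasoning
  P? : Decidable (λ (ab : Fin N × Fin N) → proj₁ ab F.< proj₂ ab × w (proj₂ ab) F.< w (proj₁ ab))
  P? (a , b) = inversion? w a b
  row : Fin N → List (Fin N × Fin N)
  row a = map (a ,_) (allFin N)

ascent? : {n : ℕ} (w : Fin (suc n) → Fin (suc n)) (i : Fin n) → Dec (w (inject₁ i) F.< w (F.suc i))
ascent? w i = w (inject₁ i) F.<? w (F.suc i)

module _ {n : ℕ} (i : Fin n) where

  sum-reindex : (f : Fin (suc n) → ℕ) → sum f ≡ sum (f ∘ s i)
  sum-reindex f = ∑-permute f (permutation (s i) (s i) (s-involutive i) (s-involutive i))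

  len-·s : (w : Fin (suc n) → Fin (suc n)) → len (w ·s i) ≤ ⟦ ascent? w i ⟧ + len w
  len-·s w = begin
    len (w ·s i)                                     ≡⟨ len-as-sum (w ·s i) ⟩
    sum (λ a → sum (λ b → ⟦ inversion? (w ·s i) a b ⟧)) ≡⟨ reindex₂ ⟩
    sum (λ a → sum (λ b → inv′ a b))                  ≤⟨ sum-≤-except (F.suc i) c outside-row row-suc-i ⟩
    c + sum (λ a → sum (λ b → ⟦ inversion? w a b ⟧))  ≡⟨ cong (c +_) (len-as-sum w) ⟨
    c + len w                                         ∎
    where
    open ℕP.≤-Reasoning
    c : ℕ
    c = ⟦ ascent? w i ⟧
    inv′ : Fin (suc n) → Fin (suc n) → ℕ
    inv′ a b = ⟦ inversion? (w ·s i) (s i a) (s i b) ⟧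
    reindex₂ : sum (λ a → sum (λ b → ⟦ inversion? (w ·s i) a b ⟧)) ≡ sum (λ a → sum (λ b → inv′ a b))
    reindex₂ = trans (sum-cong-≗ (λ a → sum-reindex (λ b → ⟦ inversion? (w ·s i) a b ⟧)))
                     (sum-reindex (λ a → sum (λ b → ⟦ inversion? (w ·s i) a (s i b) ⟧)))
    generic : ∀ a b → ¬ (a ≡ F.suc i × b ≡ inject₁ i) → inv′ a b ≤ ⟦ inversion? w a b ⟧
    generic a b notPair =
      ⟦⟧-mono (inversion? (w ·s i) (s i a) (s i b)) (inversion? w a b) λ (lt , wlt) →
        s-reflects-< i notPair lt ,
        subst₂ (λ x y → w x F.< w y) (s-involutive i b) (s-involutive i a) wlt
    -- at the pair (i+1, i) it can only be the ascent being flipped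
    exceptional : inv′ (F.suc i) (inject₁ i) ≤ c + ⟦ inversion? w (F.suc i) (inject₁ i) ⟧
    exceptional = ≤-trans
      (⟦⟧-mono (inversion? (w ·s i) (s i (F.suc i)) (s i (inject₁ i))) (ascent? w i) λ (_ , wlt) →
        subst₂ (λ x y → w x F.< w y) (s-involutive i (inject₁ i)) (s-involutive i (F.suc i)) wlt)
      (ℕP.m≤m+n c _)
    outside-row : ∀ a → a ≢ F.suc i → sum (inv′ a) ≤ sum (λ b → ⟦ inversion? w a b ⟧)
    outside-row a a≢ = sum-mono (λ b → generic a b (a≢ ∘ proj₁))
    row-suc-i : sum (inv′ (F.suc i)) ≤ c + sum (λ b → ⟦ inversion? w (F.suc i) b ⟧)
    row-suc-i = sum-≤-except (inject₁ i) c (λ b b≢ → generic (F.suc i) b (b≢ ∘ proj₂)) exceptional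

-- Chains: lengths along a chain, and why a reduced decomposition only takes
-- ascent steps.

len-cong : {N : ℕ} {v w : Fin N → Fin N} → v ≗ w → len v ≡ len w
len-cong {v = v} {w} v≗w = begin
  len v                                           ≡⟨ len-as-sum v ⟩
  sum (λ a → sum (λ b → ⟦ inversion? v a b ⟧))    ≡⟨ sum-cong-≗ (λ a → sum-cong-≗ (same a)) ⟩
  sum (λ a → sum (λ b → ⟦ inversion? w a b ⟧))    ≡⟨ len-as-sum w ⟨
  len w                                           ∎
  where
  open ≡-Reasoning
  same : ∀ a b → ⟦ inversion? v a b ⟧ ≡ ⟦ inversion? w a b ⟧
  same a b rewrite v≗w a | v≗w b = refl

len-id : {N : ℕ} → len {N} id ≡ 0
len-id {N} = begin
  len {N} id                                      ≡⟨ len-as-sum {N} id ⟩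
  sum (λ a → sum (λ b → ⟦ inversion? {N} id a b ⟧)) ≡⟨ sum-cong-≗ (λ a → sum-cong-≗ (no-inversion a)) ⟩
  sum {N} (λ _ → sum {N} (λ _ → 0))               ≡⟨ sum-cong-≗ {N} (λ _ → sum-replicate-zero N) ⟩
  sum {N} (λ _ → 0)                               ≡⟨ sum-replicate-zero N ⟩
  0                                               ∎
  where
  open ≡-Reasoning
  no-inversion : ∀ a b → ⟦ inversion? {N} id a b ⟧ ≡ 0
  no-inversion a b = ⟦⟧-refuted (inversion? id a b) (λ (a<b , b<a) → ℕP.<-asym a<b b<a)

len-·s-≤ : {n : ℕ} (w : Fin (suc n) → Fin (suc n)) (i : Fin n) → len (w ·s i) ≤ suc (len w)
len-·s-≤ w i = ≤-trans (len-·s i w) (ℕP.+-monoˡ-≤ (len w) (⟦⟧≤1 (ascent? w i)))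

len-prodFrom-≤ : {n : ℕ} (w : Fin (suc n) → Fin (suc n)) (is : List (Fin n)) →
  len (prodFrom w is) ≤ len w + length is
len-prodFrom-≤ w []       = ℕP.m≤m+n (len w) 0
len-prodFrom-≤ w (i ∷ is) = begin
  len (prodFrom (w ·s i) is)  ≤⟨ len-prodFrom-≤ (w ·s i) is ⟩
  len (w ·s i) + length is    ≤⟨ ℕP.+-monoˡ-≤ (length is) (len-·s-≤ w i) ⟩
  suc (len w) + length is     ≡⟨ ℕP.+-suc (len w) (length is) ⟨
  len w + length (i ∷ is)     ∎
  where open ℕP.≤-Reasoning

Ascending : {n : ℕ} → (Fin (suc n) → Fin (suc n)) → List (Fin n) → Set
Ascending w []       = ⊤
Ascending w (i ∷ is) = (w (inject₁ i) F.< w (F.suc i)) × Ascending (w ·s i) is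

-- A chain attaining the maximal length ℓ(w) + k is ascending: a single
-- descent step would not raise the length, leaving too few steps.
maximal⇒ascending : {n : ℕ} (w : Fin (suc n) → Fin (suc n)) (is : List (Fin n)) →
  len w + length is ≤ len (prodFrom w is) → Ascending w is
maximal⇒ascending w []       _ = tt
maximal⇒ascending w (i ∷ is) maximal with ascent? w i
... | yes asc = asc , maximal⇒ascending (w ·s i) is (begin
  len (w ·s i) + length is    ≤⟨ ℕP.+-monoˡ-≤ (length is) (len-·s-≤ w i) ⟩
  suc (len w) + length is     ≡⟨ ℕP.+-suc (len w) (length is) ⟨
  len w + length (i ∷ is)     ≤⟨ maximal ⟩
  len (prodFrom (w ·s i) is)  ∎)
  where open ℕP.≤-Reasoning
... | no desc = ⊥-elim (ℕP.<-irrefl refl (begin-strict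
  len (prodFrom (w ·s i) is)  ≤⟨ len-prodFrom-≤ (w ·s i) is ⟩
  len (w ·s i) + length is    ≤⟨ ℕP.+-monoˡ-≤ (length is) (len-·s i w) ⟩
  ⟦ ascent? w i ⟧ + len w + length is
    ≡⟨ cong (λ k → k + len w + length is) (⟦⟧-refuted (ascent? w i) desc) ⟩
  len w + length is           <⟨ ℕP.+-monoʳ-< (len w) (ℕP.n<1+n (length is)) ⟩
  len w + length (i ∷ is)     ≤⟨ maximal ⟩
  len (prodFrom (w ·s i) is)  ∎))
  where open ℕP.≤-Reasoning

prodFrom-++ : {n : ℕ} (w : Fin (suc n) → Fin (suc n)) (xs ys : List (Fin n)) →
  prodFrom w (xs ++ ys) ≡ prodFrom (prodFrom w xs) ys
prodFrom-++ w []       ys = refl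
prodFrom-++ w (x ∷ xs) ys = prodFrom-++ (w ·s x) xs ys

Ascending-++ : {n : ℕ} (w : Fin (suc n) → Fin (suc n)) (xs ys : List (Fin n)) →
  Ascending w (xs ++ ys) → Ascending (prodFrom w xs) ys
Ascending-++ w []       ys asc       = asc
Ascending-++ w (x ∷ xs) ys (_ , asc) = Ascending-++ (w ·s x) xs ys asc

-- Inversions persist along ascending chains.

Precedes : {N : ℕ} → (Fin N → Fin N) → Fin N → Fin N → Set
Precedes w y x = ∃₂ λ p q → p F.< q × w p ≡ y × w q ≡ x

Precedes-cong : {N : ℕ} {v w : Fin N → Fin N} {x y : Fin N} → v ≗ w → Precedes v y x → Precedes w y x
Precedes-cong v≗w (p , q , p<q , vp , vq) = p , q , p<q , trans (sym (v≗w p)) vp , trans (sym (v≗w q)) vq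

-- An ascent step s_i only reorders the two letters w(i) < w(i+1), so it keeps
-- every inverted pair (a larger letter y before a smaller x) inverted.
Precedes-·s : {n : ℕ} (w : Fin (suc n) → Fin (suc n)) (i : Fin n) {x y : Fin (suc n)} →
  w (inject₁ i) F.< w (F.suc i) → x F.< y → Precedes w y x → Precedes (w ·s i) y x
Precedes-·s w i asc x<y (p , q , p<q , wp , wq) =
  s i p , s i q , s-preserves-< i notPair p<q ,
  trans (cong w (s-involutive i p)) wp , trans (cong w (s-involutive i q)) wq
  where
  notPair : ¬ (p ≡ inject₁ i × q ≡ F.suc i)
  notPair (refl , refl) = ℕP.<-asym asc (subst₂ F._<_ (sym wq) (sym wp) x<y)

Precedes-prodFrom : {n : ℕ} (w : Fin (suc n) → Fin (suc n)) (is : List (Fin n)) {x y : Fin (suc n)} →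
  Ascending w is → x F.< y → Precedes w y x → Precedes (prodFrom w is) y x
Precedes-prodFrom w []       _           x<y prec = prec
Precedes-prodFrom w (i ∷ is) (asc , ascs) x<y prec =
  Precedes-prodFrom (w ·s i) is ascs x<y (Precedes-·s w i asc x<y prec)

reduced-step-inverts : {n : ℕ} (π : Perm (suc n)) (is : List (Fin n)) → ReducedDecomposition π is →
  (pre post : List (Fin n)) (i : Fin n) → is ≡ pre ++ i ∷ post →
  let u = prod pre (inject₁ i); v = prod pre (F.suc i) in
  u F.< v × Precedes (word π) v u
reduced-step-inverts {n} π is (prod≗π , length≡) pre post i refl = u<v , inverted-in-π
  where
  w : Fin (suc n) → Fin (suc n)
  w = prod pre
  chain-ascending : Ascending id (pre ++ i ∷ post)
  chain-ascending = maximal⇒ascending id (pre ++ i ∷ post) (ℕP.≤-reflexive (begin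
    len {suc n} id + length (pre ++ i ∷ post)  ≡⟨ cong (_+ length (pre ++ i ∷ post)) (len-id {suc n}) ⟩
    length (pre ++ i ∷ post)                   ≡⟨ length≡ ⟩
    len (word π)                               ≡⟨ len-cong prod≗π ⟨
    len (prod (pre ++ i ∷ post))               ∎))
    where open ≡-Reasoning
  step-ascending : Ascending w (i ∷ post)
  step-ascending = Ascending-++ id pre (i ∷ post) chain-ascending
  u<v : w (inject₁ i) F.< w (F.suc i)
  u<v = proj₁ step-ascending
  swapped : Precedes (w ·s i) (w (F.suc i)) (w (inject₁ i))
  swapped = inject₁ i , F.suc i , inject₁<suc i , cong w (s-left i) , cong w (s-right i)
  inverted-in-π : Precedes (word π) (w (F.suc i)) (w (inject₁ i))
  inverted-in-π =
    Precedes-cong (λ p → trans (sym (cong-app (prodFrom-++ id pre (i ∷ post)) p)) (prod≗π p))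
    (Precedes-prodFrom (w ·s i) post (proj₂ step-ascending) u<v swapped)

-- Injective self-maps of Fin N: the counting facts behind direct sums.

∀-or-counterexample : {N : ℕ} {P Q : Pred (Fin N) 0ℓ} → Decidable P → Decidable Q →
  (∀ x → P x → Q x) ⊎ ∃ λ x → P x × ¬ Q x
∀-or-counterexample {N} P? Q? with all? (λ x → P? x →-dec Q? x)
... | yes holds = inj₁ holds
... | no fails with ¬∀⟶∃¬ N _ (λ x → P? x →-dec Q? x) fails
...   | x , ¬P⇒Q = inj₂ (x , decidable-stable (P? x) (λ ¬Px → ¬P⇒Q (⊥-elim ∘ ¬Px)) , ¬P⇒Q ∘ (λ Qx _ → Qx))

-- Pigeonhole: an injective self-map of Fin N is surjective, for otherwise it
-- would squeeze Fin N injectively into Fin (N-1).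
injective⇒surjective : {N : ℕ} {f : Fin N → Fin N} → Injective _≡_ _≡_ f → ∀ y → ∃ λ x → f x ≡ y
injective⇒surjective {suc N} {f} f-inj y with any? (λ x → f x ≟ y)
... | yes hit = hit
... | no miss = ⊥-elim (ℕP.1+n≰n (injective⇒≤ squeezed-injective))
  where
  squeezed : Fin (suc N) → Fin N
  squeezed x = F.punchOut {i = y} {j = f x} (λ y≡fx → miss (x , sym y≡fx))
  squeezed-injective : Injective _≡_ _≡_ squeezed
  squeezed-injective {x} {x′} e =
    f-inj (punchOut-injective {i = y} (λ y≡fx → miss (x , sym y≡fx)) (λ y≡fx → miss (x′ , sym y≡fx)) e)

PrefixClosed : {N : ℕ} → (Fin N → Fin N) → ℕ → Set
PrefixClosed f c = ∀ p → toℕ p < c → toℕ (f p) < c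

module _ {N : ℕ} {f : Fin N → Fin N} (f-inj : Injective _≡_ _≡_ f) where

  -- A closed prefix is mapped onto itself: f restricts to an injective, hence
  -- surjective, self-map of Fin c.
  module _ (c : ℕ) (c≤N : c ≤ N) (closed : PrefixClosed f c) where

    private
      embed : Fin c → Fin N
      embed k = F.inject≤ k c≤N

      embed<c : ∀ k → toℕ (embed k) < c
      embed<c k = subst (_< c) (sym (toℕ-inject≤ k c≤N)) (toℕ<n k)

      restrict : Fin c → Fin c
      restrict k = F.fromℕ< (closed (embed k) (embed<c k))

      toℕ-restrict : ∀ k → toℕ (restrict k) ≡ toℕ (f (embed k))
      toℕ-restrict k = toℕ-fromℕ< _

      restrict-injective : Injective _≡_ _≡_ restrict
      restrict-injective {k} {k′} e = inject≤-injective c≤N c≤N k k′ (f-inj (toℕ-injective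
        (trans (sym (toℕ-restrict k)) (trans (cong toℕ e) (toℕ-restrict k′)))))

    prefixClosed⇒onto : ∀ v → toℕ v < c → ∃ λ p → toℕ p < c × f p ≡ v
    prefixClosed⇒onto v v<c with injective⇒surjective restrict-injective (F.fromℕ< v<c)
    ... | k , restrict-k≡v = embed k , embed<c k ,
      toℕ-injective (trans (sym (toℕ-restrict k)) (trans (cong toℕ restrict-k≡v) (toℕ-fromℕ< v<c)))

  prefixClosed⇒suffixClosed : (c : ℕ) → PrefixClosed f c → ∀ q → c ≤ toℕ q → c ≤ toℕ (f q)
  prefixClosed⇒suffixClosed c closed q c≤q with toℕ (f q) ℕ.<? c
  ... | no ¬fq<c = ℕP.≮⇒≥ ¬fq<c
  ... | yes fq<c with prefixClosed⇒onto c (ℕP.≤-trans c≤q (ℕP.<⇒≤ (toℕ<n q))) closed (f q) fq<c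
  ...   | p , p<c , fp≡fq =
    ⊥-elim (ℕP.<-irrefl refl (ℕP.<-≤-trans p<c (subst (λ r → c ≤ toℕ r) (sym (f-inj fp≡fq)) c≤q)))

-- If some position of the prefix [0, c) holds a letter ≥ c, then some position
-- of the suffix holds a letter < c: otherwise the inverse of f would map its
-- prefix into itself, hence its suffix into itself, and send f(p) back to p ≥ c.
escape⇒return : {N : ℕ} {f : Fin N → Fin N} → Injective _≡_ _≡_ f → (c : ℕ) (p : Fin N) →
  toℕ p < c → c ≤ toℕ (f p) → ∃ λ q → c ≤ toℕ q × toℕ (f q) < c
escape⇒return {N} {f} f-inj c p p<c c≤fp
  with ∀-or-counterexample (λ q → c ℕ.≤? toℕ q) (λ q → c ℕ.≤? toℕ (f q))
... | inj₂ (q , c≤q , ¬c≤fq) = q , c≤q , ℕP.≰⇒> ¬c≤fq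
... | inj₁ suffixClosed = ⊥-elim (ℕP.<⇒≱ p<c (subst (λ r → c ≤ toℕ r) g∘f≡id
        (prefixClosed⇒suffixClosed g-inj c g-prefixClosed (f p) c≤fp)))
  where
  g : Fin N → Fin N
  g y = proj₁ (injective⇒surjective f-inj y)
  f∘g≡id : ∀ y → f (g y) ≡ y
  f∘g≡id y = proj₂ (injective⇒surjective f-inj y)
  g-inj : Injective _≡_ _≡_ g
  g-inj {y} {y′} e = trans (sym (f∘g≡id y)) (trans (cong f e) (f∘g≡id y′))
  g∘f≡id : g (f p) ≡ p
  g∘f≡id = f-inj (f∘g≡id (f p))
  g-prefixClosed : PrefixClosed g c
  g-prefixClosed v v<c with toℕ (g v) ℕ.<? c
  ... | yes gv<c = gv<c
  ... | no ¬gv<c = ⊥-elim (ℕP.<⇒≱ v<c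
    (subst (λ r → c ≤ toℕ r) (f∘g≡id v) (suffixClosed (g v) (ℕP.≮⇒≥ ¬gv<c))))

-- f splits at c when every letter below c occurs before every letter ≥ c,
-- i.e. f is a direct sum σ ⊕ τ with σ a permutation of the first c letters.
SplitsAt : {N : ℕ} → (Fin N → Fin N) → ℕ → Set
SplitsAt f c = ∀ p q → p F.< q → toℕ (f q) < c → c ≤ toℕ (f p) → ⊥

-- A closed prefix [0, c) makes f a direct sum at c: a letter ≥ c cannot sit in the
-- prefix, and a letter < c cannot sit in the suffix.
prefixClosed⇒splits : {N : ℕ} {f : Fin N → Fin N} → Injective _≡_ _≡_ f → (c : ℕ) →
  PrefixClosed f c → SplitsAt f c
prefixClosed⇒splits f-inj c closed p q p<q fq<c c≤fp with toℕ p ℕ.<? c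
... | yes p<c = ℕP.<⇒≱ (closed p p<c) c≤fp
... | no ¬p<c = ℕP.<⇒≱ fq<c
  (prefixClosed⇒suffixClosed f-inj c closed q (≤-trans (ℕP.≮⇒≥ ¬p<c) (ℕP.<⇒≤ p<q)))

lastWitness : {N : ℕ} {P : Pred (Fin N) 0ℓ} → Decidable P → ∃ P →
  ∃ λ k → P k × (∀ r → k F.< r → ¬ P r)
lastWitness {suc N} P? (x , Px) with any? (P? ∘ F.suc)
lastWitness {suc N} P? (x , Px) | yes later with lastWitness (P? ∘ F.suc) later
... | k , Pk , none-after = F.suc k , Pk , λ { (F.suc r) (s≤s k<r) → none-after r k<r }
lastWitness {suc N} P? (zero , P0)    | no none-later = zero , P0 , λ { (F.suc r) _ Pr → none-later (r , Pr) }
lastWitness {suc N} P? (F.suc x , Px) | no none-later = ⊥-elim (none-later (x , Px))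

-- Separable permutations with a₁ < aₙ are direct sums.

module _ {n : ℕ} (π : Perm (suc (suc n))) (sep : Separable π) where

  smaller-than-first : toℕ (word π zero) ≢ 0 → ∃ λ r → word π r F.< word π zero
  smaller-than-first π0≢0 with injective⇒surjective (inj π) zero
  ... | r , πr≡0 = r , subst (F._< word π zero) (sym πr≡0) (ℕP.n≢0⇒n>0 π0≢0)

  -- Let k be the last position whose letter is smaller than π(0).  A position
  -- p ≤ k holding a letter > k together with a position q > k holding a
  -- letter ≤ k would place the pattern 2413 at positions 0 < p < k < q.
  no-straddle : (k : Fin (suc (suc n))) → word π k F.< word π zero →
    (∀ r → k F.< r → ¬ (word π r F.< word π zero)) →
    (p q : Fin (suc (suc n))) → toℕ p < suc (toℕ k) → suc (toℕ k) ≤ toℕ (word π p) →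
    k F.< q → toℕ (word π q) < suc (toℕ k) → ⊥
  no-straddle k πk<π0 last p q p≤k k<πp k<q πq≤k =
    proj₂ (sep zero p k q 0<p p<k k<q) (πk<π0 , π0<πq , πq<πp)
    where
    πq<πp : word π q F.< word π p
    πq<πp = ℕP.<-≤-trans πq≤k k<πp
    π0<πq : word π zero F.< word π q
    π0<πq = ℕP.≤∧≢⇒< (ℕP.≮⇒≥ (last q k<q)) λ e →
      ℕP.n≮0 (subst (k F.<_) (sym (inj π (toℕ-injective e))) k<q)
    0<p : F.zero {suc n} F.< p
    0<p = ℕP.n≢0⇒n>0 λ p≡0 →
      ℕP.<-irrefl (cong (toℕ ∘ word π) (sym (toℕ-injective {j = zero} p≡0))) (ℕP.<-trans π0<πq πq<πp)
    p<k : p F.< k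
    p<k = ℕP.≤∧≢⇒< (ℕP.≤-pred p≤k) λ p≡k →
      ℕP.<-irrefl (cong (toℕ ∘ word π) (sym (toℕ-injective p≡k)))
        (ℕP.<-trans πk<π0 (ℕP.<-trans π0<πq πq<πp))

  -- With k as above, π splits after position k: either the prefix [0, k] is
  -- closed, or a prefix letter escapes and, by counting, a suffix letter returns,
  -- which no-straddle forbids.  Since π(0) < π(n+1), k is not the last position.
  splits-after-last-smaller : word π zero F.< word π (fromℕ (suc n)) →
    (k : Fin (suc (suc n))) → word π k F.< word π zero →
    (∀ r → k F.< r → ¬ (word π r F.< word π zero)) →
    ∃ λ m → 1 ≤ m × m < suc (suc n) × SplitsAt (word π) m
  splits-after-last-smaller a₁<aₙ k πk<π0 last
    with ∀-or-counterexample (λ p → toℕ p ℕ.<? suc (toℕ k)) (λ p → toℕ (word π p) ℕ.<? suc (toℕ k))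
  ... | inj₁ closed = suc (toℕ k) , s≤s z≤n , s≤s k<n+1 , prefixClosed⇒splits (inj π) _ closed
    where
    k<n+1 : toℕ k < suc n
    k<n+1 = ℕP.≤∧≢⇒< (ℕP.≤-pred (toℕ<n k)) λ k≡n+1 →
      ℕP.<-asym πk<π0 (subst (λ r → word π zero F.< word π r)
        (toℕ-injective (trans (toℕ-fromℕ (suc n)) (sym k≡n+1))) a₁<aₙ)
  ... | inj₂ (p , p≤k , ¬πp≤k) with escape⇒return (inj π) (suc (toℕ k)) p p≤k (ℕP.≮⇒≥ ¬πp≤k)
  ...   | q , k<q , πq≤k = ⊥-elim (no-straddle k πk<π0 last p q p≤k (ℕP.≮⇒≥ ¬πp≤k) k<q πq≤k)

-- A separable π with a₁ < aₙ splits as a direct sum at some 1 ≤ m < n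
-- (m = 1 when a₁ = 1, otherwise after the last letter smaller than a₁).
separable⇒splits : (n : ℕ) (π : Perm (suc n)) → Separable π → word π zero F.< word π (fromℕ n) →
  ∃ λ m → 1 ≤ m × m < suc n × SplitsAt (word π) m
separable⇒splits zero    π sep a₁<aₙ = ⊥-elim (ℕP.<-irrefl refl a₁<aₙ)
separable⇒splits (suc n) π sep a₁<aₙ with toℕ (word π zero) ℕ.≟ 0
... | yes π0≡0 = 1 , ≤-refl , s≤s (s≤s z≤n) , prefixClosed⇒splits (inj π) 1 first-is-1
  where
  first-is-1 : PrefixClosed (word π) 1
  first-is-1 zero      _         = subst (_< 1) (sym π0≡0) (s≤s z≤n)
  first-is-1 (F.suc _) (s≤s ())
... | no π0≢0 with lastWitness (λ r → word π r F.<? word π zero) (smaller-than-first π sep π0≢0)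
...   | k , πk<π0 , last = splits-after-last-smaller π sep a₁<aₙ k πk<π0 last

-- A step of a reduced decomposition swaps letters u < v with v before u in π,
-- so at a splitting point m it cannot swap a letter < m with one ≥ m.
splits⇒noStepCrosses : {n : ℕ} (π : Perm (suc n)) (m : ℕ) (is : List (Fin n)) →
  SplitsAt (word π) m → ReducedDecomposition π is → NoStepCrosses m is
splits⇒noStepCrosses π m is splits reduced pre post i is≡ separated
  with reduced-step-inverts π is reduced pre post i is≡
... | u<v , (p , q , p<q , πp≡v , πq≡u) with separated
...   | inj₁ (u<m , ¬v<m) =
  splits p q p<q (subst (λ x → toℕ x < m) (sym πq≡u) u<m)
    (subst (λ x → m ≤ toℕ x) (sym πp≡v) (ℕP.≮⇒≥ ¬v<m))
...   | inj₂ (¬u<m , v<m) = ¬u<m (ℕP.<-trans u<v v<m)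

lemma3p3 : (n : ℕ) (π : Perm (suc n)) → Separable π →
    word π zero Data.Fin.< word π (fromℕ n) →
    (is : List (Fin n)) → ReducedDecomposition π is →
    Σ ℕ (λ m → (1 ≤ m) × (m < suc n) × NoStepCrosses m is)
lemma3p3 n π sep a₁<aₙ is reduced with separable⇒splits n π sep a₁<aₙ
... | m , 1≤m , m<n+1 , splits = m , 1≤m , m<n+1 , splits⇒noStepCrosses π m is splits reduced
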